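{- Let $\pi=(\pi_1\mid\cdots\mid\pi_d)\in\mathcal{OP}(n,d,r)$ and $\sigma\in\mathfrak{S}_d$, and let $\sigma(\pi)$ be the ordered set partition with $\sigma(\pi)_i=\pi_{\sigma^{ -1}(i)}$. Then the map sending $T\in\mathcal{J}_r(\pi)$ to the tableau $T'$ obtained by permuting the columns of $T$ according to $\sigma$ (column $j$ of $T$ becomes column $\sigma(j)$ of $T'$) is a bijection $\mathcal{J}_r(\pi)\to\mathcal{J}_r(\sigma(\pi))$, and $\mathrm{sgn}(T)=\mathrm{sgn}(\sigma)^r\,\mathrm{sgn}(T')$.
   Context: An ordered set partition of $[n]$ with $d$ blocks is a sequence $\pi=(\pi_1\mid\cdots\mid\pi_d)$ of nonempty pairwise disjoint subsets of $[n]$ with union $[n]$; $\mathcal{OP}(n,d,r)$ is the set of those with every block of size at least $r$. An $r$-jellyfish tableau for $\pi$ is an array $T$ with $n-(d-1)r$ rows and $d$ columns, cells empty or containing elements of $[n]$, such that all cells in rows $1,\dots,r$ are nonempty, each row $i>r$ has exactly one nonempty cell, and the nonempty entries of column $j$ are exactly $\pi_j$, increasing downward; $\mathcal{J}_r(\pi)$ is their set. $\mathrm{sgn}(T)=(-1)^{\mathrm{inv}(T)}$, $\mathrm{inv}(T)$ being the number of inversions (pairs of entries in decreasing order) of the row reading word (rows read left to right, top to bottom, empty cells skipped). $\mathrm{sgn}(\sigma)$ is the sign of the permutation $\sigma$. -}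

module Defs where

open import Data.Nat as ℕ using (ℕ; zero; suc; _∸_; _≤_)
open import Data.Fin as Fin using (Fin; toℕ; _<?_)
open import Data.Fin.Subset using (Subset; _∈_; _∩_; ∣_∣; Nonempty; Empty)
open import Data.Fin.Permutation using (Permutation′; _⟨$⟩ʳ_; _⟨$⟩ˡ_)
open import Data.Integer as ℤ using (ℤ; -_; 1ℤ)
open import Data.List as List using (List; []; _∷_; length; filter; concatMap; mapMaybe)
open import Data.Maybe using (Maybe; just; nothing; Is-just)
open import Data.Vec as Vec using (Vec; lookup; tabulate; toList)
open import Data.Product using (Σ; ∃; _×_)
open import Relation.Binary.PropositionalEquality using (_≡_; _≢_)
open import Function.Bundles using (_⇔_)

record IsOrderedSetPartition (n d : ℕ) (π : Fin d → Subset n) : Set where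
  field
    nonempty : ∀ j → Nonempty (π j)
    disjoint : ∀ i j → i ≢ j → Empty (π i ∩ π j)
    covers   : ∀ x → ∃ λ j → x ∈ π j

record InOP (n d r : ℕ) (π : Fin d → Subset n) : Set where
  field
    isOSP    : IsOrderedSetPartition n d π
    bigBlock : ∀ j → r ≤ ∣ π j ∣

rows : ℕ → ℕ → ℕ → ℕ
rows n d r = n ∸ (d ∸ 1) ℕ.* r

Array : ℕ → ℕ → ℕ → Set
Array n m d = Vec (Vec (Maybe (Fin n)) d) m

cell : ∀ {n m d} → Array n m d → Fin m → Fin d → Maybe (Fin n)
cell T i j = lookup (lookup T i) j

-- T is an r-jellyfish tableau for π (rows indexed 0..m-1, so "rows 1..r"
-- are those with toℕ i < r).
record IsJellyfish (n d r : ℕ) (π : Fin d → Subset n)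
                   (T : Array n (rows n d r) d) : Set where
  field
    topFull    : ∀ i j → toℕ i ℕ.< r → Is-just (cell T i j)
    lowerOne   : ∀ i → r ≤ toℕ i →
                 Σ (Fin d) λ j → Is-just (cell T i j) ×
                   (∀ k → k ≢ j → cell T i k ≡ nothing)
    columns    : ∀ j x → (x ∈ π j) ⇔ (∃ λ i → cell T i j ≡ just x)
    increasing : ∀ j i i' a b → i Fin.< i' → cell T i j ≡ just a →
                 cell T i' j ≡ just b → a Fin.< b

inv : ∀ {k} → List (Fin k) → ℕ
inv []       = 0
inv (x ∷ xs) = length (filter (λ y → y <? x) xs) ℕ.+ inv xs

neg1^ : ℕ → ℤ
neg1^ zero    = 1ℤ
neg1^ (suc k) = - neg1^ k

readingWord : ∀ {n m d} → Array n m d → List (Fin n)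
readingWord T = concatMap (λ row → mapMaybe (λ c → c) (toList row)) (toList T)

sgnT : ∀ {n m d} → Array n m d → ℤ
sgnT T = neg1^ (inv (readingWord T))

sgnPerm : ∀ {d} → Permutation′ d → ℤ
sgnPerm {d} σ = neg1^ (inv (toList (tabulate {n = d} (σ ⟨$⟩ʳ_))))

permPart : ∀ {n d} → Permutation′ d → (Fin d → Subset n) → Fin d → Subset n
permPart σ π i = π (σ ⟨$⟩ˡ i)

-- Column j of T becomes column σ(j) of T'.
permCols : ∀ {n m d} → Permutation′ d → Array n m d → Array n m d
permCols σ T = Vec.map (λ row → tabulate (λ k → lookup row (σ ⟨$⟩ˡ k))) T

{-# OPTIONS --safe #-}
module Submission where

-- Permuting the columns permutes the entries within each row, so every row word, and hence
-- the whole reading word, keeps its multiset of letters. Since inv (u ++ v) = inv u + inv v +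
-- (pairs y < x with x in u, y in v) and the last term only depends on the two multisets, the
-- sign can be compared row by row. A row with one entry keeps its word; each of the r full
-- rows has distinct entries a and becomes a ∘ σ⁻¹, and sgn a = sgn σ · sgn (a ∘ σ⁻¹) because
-- inv w + inv τ + inv (w ∘ τ) is even: the terms for (p, q) and (q, p) together count the
-- disagreements among three comparisons. Finally r ≤ n − (d − 1) r, as the column of a
-- block of size at least r must have that many rows.

open import Defs
open import Data.Bool using (Bool; true; false; not; _∧_)
open import Data.Empty using (⊥-elim)
open import Data.Fin using (Fin; zero; suc; toℕ; _<?_; _≟_; punchIn; punchOut)
import Data.Fin.Properties as FinP
open import Data.Fin.Permutation using (Permutation′; _⟨$⟩ʳ_; _⟨$⟩ˡ_; flip; inverseˡ; inverseʳ)
open import Data.Integer using (ℤ; -_; 1ℤ; _*_; _^_)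
import Data.Integer.Properties as ℤP
import Data.Integer.Tactic.RingSolver as ℤSolver
open import Data.List using (List; []; _∷_; _++_; length; filter; map; mapMaybe)
open import Data.Maybe using (Maybe; just; nothing; maybe′; _>>=_; Is-just; to-witness)
import Data.Maybe.Relation.Unary.Any as MaybeAny
open import Data.Product using (Σ; ∃; _×_; _,_; proj₁; proj₂)
open import Data.Fin.Subset using (Subset; _∈_; _∩_; Empty; ∣_∣; inside; outside)
import Data.Fin.Subset.Properties as SubsetP
import Data.List.Properties as ListP
open import Data.Nat as ℕ using (ℕ; zero; suc; _+_; _≤_; _<_; z≤n; s≤s)
import Data.Nat.Properties as ℕP
open import Data.Nat.ListAction using () renaming (sum to sumₗ)
open import Data.Nat.ListAction.Properties using () renaming (sum-++ to sumₗ-++)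
open import Data.Nat.Tactic.RingSolver using (solve-∀)
open import Data.Vec using (Vec; []; _∷_; here; there; lookup; tabulate; toList)
import Data.Vec.Properties as VecP
open import Function using (_∘_; id; case_of_)
open import Function.Bundles using (Equivalence; mk⇔)
open import Function.Definitions using (Injective)
open import Relation.Binary.PropositionalEquality
open import Relation.Nullary using (does; yes; no)
open import Relation.Unary using (Pred; Decidable)

open import Algebra.Properties.CommutativeMonoid.Sum ℕP.+-0-commutativeMonoid
  using (sum; sum-syntax; ∑-distrib-+; sum-cong-≗; sum-permute; sum-replicate-zero)

neg1^-+ : ∀ a b → neg1^ (a + b) ≡ neg1^ a * neg1^ b
neg1^-+ zero    b = sym (ℤP.*-identityˡ (neg1^ b))
neg1^-+ (suc a) b = trans (cong -_ (neg1^-+ a b)) (ℤP.neg-distribˡ-* (neg1^ a) (neg1^ b))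

neg1^-square : ∀ a → neg1^ a * neg1^ a ≡ 1ℤ
neg1^-square zero    = refl
neg1^-square (suc a) = begin
  - neg1^ a * - neg1^ a   ≡⟨ neg*neg (neg1^ a) ⟩
  neg1^ a * neg1^ a       ≡⟨ neg1^-square a ⟩
  1ℤ                      ∎
  where
  open ≡-Reasoning
  neg*neg : ∀ x → - x * - x ≡ x * x
  neg*neg = ℤSolver.solve-∀

record Even (n : ℕ) : Set where
  constructor mkEven
  field neg1^≡1 : neg1^ n ≡ 1ℤ

even-+ : ∀ {a b} → Even a → Even b → Even (a + b)
even-+ {a} {b} (mkEven ea) (mkEven eb) = mkEven (trans (neg1^-+ a b) (cong₂ _*_ ea eb))

even-+⇒neg1^-* : ∀ a b c → Even ((a + b) + c) → neg1^ a ≡ neg1^ b * neg1^ c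
even-+⇒neg1^-* a b c (mkEven even) = begin
  x                                ≡⟨ ℤP.*-identityʳ x ⟨
  x * 1ℤ                           ≡⟨ cong (x *_) (cong₂ _*_ (neg1^-square b) (neg1^-square c)) ⟨
  x * ((y * y) * (z * z))          ≡⟨ regroup x y z ⟩
  ((x * y) * z) * (y * z)          ≡⟨ cong (_* (y * z)) split ⟨
  neg1^ ((a + b) + c) * (y * z)    ≡⟨ cong (_* (y * z)) even ⟩
  1ℤ * (y * z)                     ≡⟨ ℤP.*-identityˡ (y * z) ⟩
  y * z                            ∎
  where
  open ≡-Reasoning
  x = neg1^ a
  y = neg1^ b
  z = neg1^ c
  split : neg1^ ((a + b) + c) ≡ (x * y) * z
  split = trans (neg1^-+ (a + b) c) (cong (_* z) (neg1^-+ a b))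
  regroup : ∀ x y z → x * ((y * y) * (z * z)) ≡ ((x * y) * z) * (y * z)
  regroup = ℤSolver.solve-∀

even-∑ : ∀ {d} (f : Fin d → ℕ) → (∀ i → Even (f i)) → Even (sum f)
even-∑ {zero}  f even = mkEven refl
even-∑ {suc d} f even = even-+ (even zero) (even-∑ (f ∘ suc) (even ∘ suc))

∑∑-distrib-+ : ∀ {d} (A B : Fin d → Fin d → ℕ) →
  ∑[ p < d ] ∑[ q < d ] (A p q + B p q) ≡ ∑[ p < d ] ∑[ q < d ] A p q + ∑[ p < d ] ∑[ q < d ] B p q
∑∑-distrib-+ {d} A B = trans (sum-cong-≗ (λ p → ∑-distrib-+ (A p) (B p)))
                             (∑-distrib-+ (λ p → ∑[ q < d ] A p q) _)

-- Split off the first row and column; the two off-diagonal strips pair up.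
even-∑∑ : ∀ {d} (K : Fin d → Fin d → ℕ) →
  (∀ p → Even (K p p)) → (∀ p q → p ≢ q → Even (K p q + K q p)) →
  Even (∑[ p < d ] ∑[ q < d ] K p q)
even-∑∑ {zero}  K diagonal pairs = mkEven refl
even-∑∑ {suc d} K diagonal pairs = subst Even (sym split)
  (even-+ (even-+ (diagonal zero) (even-∑ _ (λ q → pairs zero (suc q) λ ())))
          (even-∑∑ (λ p q → K (suc p) (suc q)) (diagonal ∘ suc)
             (λ p q p≢q → pairs (suc p) (suc q) (p≢q ∘ FinP.suc-injective))))
  where
  row    = ∑[ q < d ] K zero (suc q)
  column = ∑[ p < d ] K (suc p) zero
  rest   = ∑[ p < d ] ∑[ q < d ] K (suc p) (suc q)
  regroup : ∀ a r c s → (a + r) + (c + s) ≡ (a + (r + c)) + s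
  regroup = solve-∀
  split : ∑[ p < suc d ] ∑[ q < suc d ] K p q
        ≡ (K zero zero + ∑[ q < d ] (K zero (suc q) + K (suc q) zero)) + rest
  split = begin
    (K zero zero + row) + ∑[ p < d ] (K (suc p) zero + ∑[ q < d ] K (suc p) (suc q))
      ≡⟨ cong ((K zero zero + row) +_) (∑-distrib-+ (λ p → K (suc p) zero) _) ⟩
    (K zero zero + row) + (column + rest)
      ≡⟨ regroup (K zero zero) row column rest ⟩
    (K zero zero + (row + column)) + rest
      ≡⟨ cong (λ t → (K zero zero + t) + rest) (∑-distrib-+ (λ q → K zero (suc q)) _) ⟨
    (K zero zero + ∑[ q < d ] (K zero (suc q) + K (suc q) zero)) + rest ∎
    where open ≡-Reasoning

⟨$⟩ʳ-injective : ∀ {d} (σ : Permutation′ d) → Injective _≡_ _≡_ (σ ⟨$⟩ʳ_)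
⟨$⟩ʳ-injective σ eq = trans (sym (inverseˡ σ)) (trans (cong (σ ⟨$⟩ˡ_) eq) (inverseˡ σ))

χ : Bool → ℕ
χ true  = 1
χ false = 0

_<ᵇ_ : ∀ {k} → Fin k → Fin k → Bool
x <ᵇ y = toℕ x ℕ.<ᵇ toℕ y

<ᵇ-irrefl : ∀ {k} (x : Fin k) → x <ᵇ x ≡ false
<ᵇ-irrefl x = go (toℕ x)
  where
  go : ∀ m → (m ℕ.<ᵇ m) ≡ false
  go zero    = refl
  go (suc m) = go m

<ᵇ-asym : ∀ {k} (x y : Fin k) → (x <ᵇ y) ∧ (y <ᵇ x) ≡ false
<ᵇ-asym x y = go (toℕ x) (toℕ y)
  where
  go : ∀ m n → (m ℕ.<ᵇ n) ∧ (n ℕ.<ᵇ m) ≡ false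
  go zero    zero    = refl
  go zero    (suc n) = refl
  go (suc m) zero    = refl
  go (suc m) (suc n) = go m n

<ᵇ-flip : ∀ {k} (x y : Fin k) → x ≢ y → y <ᵇ x ≡ not (x <ᵇ y)
<ᵇ-flip x y x≢y = go (toℕ x) (toℕ y) (x≢y ∘ FinP.toℕ-injective)
  where
  go : ∀ m n → m ≢ n → (n ℕ.<ᵇ m) ≡ not (m ℕ.<ᵇ n)
  go zero    zero    m≢n = ⊥-elim (m≢n refl)
  go zero    (suc n) m≢n = refl
  go (suc m) zero    m≢n = refl
  go (suc m) (suc n) m≢n = go m n (m≢n ∘ cong suc)

inversions : ∀ {d k} → (Fin d → Fin k) → ℕ
inversions {d} w = ∑[ p < d ] ∑[ q < d ] χ (p <ᵇ q ∧ w q <ᵇ w p)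

sgn : ∀ {d k} → (Fin d → Fin k) → ℤ
sgn w = neg1^ (inversions w)

inversions-cong : ∀ {d k} {w w′ : Fin d → Fin k} → w ≗ w′ → inversions w ≡ inversions w′
inversions-cong w≗w′ = sum-cong-≗ λ p → sum-cong-≗ λ q →
  cong₂ (λ a b → χ (p <ᵇ q ∧ a <ᵇ b)) (w≗w′ q) (w≗w′ p)

inversions-id : ∀ {d} → inversions {d} id ≡ 0
inversions-id {d} = trans (sum-cong-≗ {y = λ _ → 0} λ p → no-inversion-from p) (sum-replicate-zero d)
  where
  no-inversion-from : ∀ p → ∑[ q < d ] χ (p <ᵇ q ∧ q <ᵇ p) ≡ 0
  no-inversion-from p =
    trans (sum-cong-≗ {y = λ _ → 0} λ q → cong χ (<ᵇ-asym p q)) (sum-replicate-zero d)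

-- [a ≠ b] + [b ≠ c] + [a ≠ c] is even; the six terms are arranged as they arise in
-- inversions-∘-even for a pair (p, q) together with (q, p).
disagreements-even : ∀ a b c →
  Even ((χ (b ∧ not c) + χ (a ∧ not b) + χ (a ∧ not c))
      + (χ (not b ∧ c) + χ (not a ∧ b) + χ (not a ∧ c)))
disagreements-even true  true  true  = mkEven refl
disagreements-even true  true  false = mkEven refl
disagreements-even true  false true  = mkEven refl
disagreements-even true  false false = mkEven refl
disagreements-even false true  true  = mkEven refl
disagreements-even false true  false = mkEven refl
disagreements-even false false true  = mkEven refl
disagreements-even false false false = mkEven refl

inversions-∘-even : ∀ {d k} (w : Fin d → Fin k) (τ : Permutation′ d) → Injective _≡_ _≡_ w →
  Even ((inversions w + inversions (τ ⟨$⟩ʳ_)) + inversions (w ∘ (τ ⟨$⟩ʳ_)))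
inversions-∘-even {d} w τ w-inj = subst Even (sym decomposition) (even-∑∑ K diagonal pairs)
  where
  t = τ ⟨$⟩ʳ_
  A B C K : Fin d → Fin d → ℕ
  A p q = χ (t p <ᵇ t q ∧ w (t q) <ᵇ w (t p))
  B p q = χ (p <ᵇ q ∧ t q <ᵇ t p)
  C p q = χ (p <ᵇ q ∧ w (t q) <ᵇ w (t p))
  K p q = A p q + B p q + C p q

  inversions-w-reindexed : inversions w ≡ ∑[ p < d ] ∑[ q < d ] A p q
  inversions-w-reindexed = trans (sum-permute (λ x → ∑[ y < d ] χ (x <ᵇ y ∧ w y <ᵇ w x)) τ)
    (sum-cong-≗ λ p → sum-permute (λ y → χ (t p <ᵇ y ∧ w y <ᵇ w (t p))) τ)

  decomposition : (inversions w + inversions t) + inversions (w ∘ t) ≡ ∑[ p < d ] ∑[ q < d ] K p q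
  decomposition = begin
    (inversions w + inversions t) + inversions (w ∘ t)
      ≡⟨ cong (λ x → (x + inversions t) + inversions (w ∘ t)) inversions-w-reindexed ⟩
    (∑[ p < d ] ∑[ q < d ] A p q + inversions t) + inversions (w ∘ t)
      ≡⟨ cong (_+ inversions (w ∘ t)) (∑∑-distrib-+ A B) ⟨
    ∑[ p < d ] ∑[ q < d ] (A p q + B p q) + inversions (w ∘ t)
      ≡⟨ ∑∑-distrib-+ (λ p q → A p q + B p q) C ⟨
    ∑[ p < d ] ∑[ q < d ] K p q ∎
    where open ≡-Reasoning

  diagonal : ∀ p → Even (K p p)
  diagonal p rewrite <ᵇ-irrefl p | <ᵇ-irrefl (t p) = mkEven refl

  pairs : ∀ p q → p ≢ q → Even (K p q + K q p)
  pairs p q p≢q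
    rewrite <ᵇ-flip p q p≢q
          | <ᵇ-flip (t p) (t q) (p≢q ∘ ⟨$⟩ʳ-injective τ)
          | <ᵇ-flip (w (t p)) (w (t q)) (p≢q ∘ ⟨$⟩ʳ-injective τ ∘ w-inj)
    = disagreements-even (p <ᵇ q) (t p <ᵇ t q) (w (t p) <ᵇ w (t q))

sgn-∘ : ∀ {d k} (w : Fin d → Fin k) (τ : Permutation′ d) → Injective _≡_ _≡_ w →
  sgn w ≡ sgn (τ ⟨$⟩ʳ_) * sgn (w ∘ (τ ⟨$⟩ʳ_))
sgn-∘ w τ w-inj = even-+⇒neg1^-* (inversions w) (inversions (τ ⟨$⟩ʳ_)) (inversions (w ∘ (τ ⟨$⟩ʳ_)))
  (inversions-∘-even w τ w-inj)

sgn-inverse : ∀ {d} (σ : Permutation′ d) → sgn (σ ⟨$⟩ˡ_) ≡ sgn (σ ⟨$⟩ʳ_)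
sgn-inverse {d} σ = sym (begin
  sgn (σ ⟨$⟩ʳ_)
    ≡⟨ sgn-∘ (σ ⟨$⟩ʳ_) (flip σ) (⟨$⟩ʳ-injective σ) ⟩
  sgn (σ ⟨$⟩ˡ_) * neg1^ (inversions (λ i → σ ⟨$⟩ʳ (σ ⟨$⟩ˡ i)))
    ≡⟨ cong (λ n → sgn (σ ⟨$⟩ˡ_) * neg1^ n) no-inversions ⟩
  sgn (σ ⟨$⟩ˡ_) * 1ℤ
    ≡⟨ ℤP.*-identityʳ _ ⟩
  sgn (σ ⟨$⟩ˡ_) ∎)
  where
  open ≡-Reasoning
  no-inversions : inversions (λ i → σ ⟨$⟩ʳ (σ ⟨$⟩ˡ i)) ≡ 0
  no-inversions = trans (inversions-cong {w′ = id} (λ i → inverseʳ σ)) (inversions-id {d})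

length-filter≡sumₗ : ∀ {a p} {A : Set a} {P : Pred A p} (P? : Decidable P) xs →
  length (filter P? xs) ≡ sumₗ (map (χ ∘ does ∘ P?) xs)
length-filter≡sumₗ P? []       = refl
length-filter≡sumₗ P? (x ∷ xs) with does (P? x)
... | true  = cong suc (length-filter≡sumₗ P? xs)
... | false = length-filter≡sumₗ P? xs

sumₗ-map-++ : ∀ {a} {A : Set a} (g : A → ℕ) xs ys →
  sumₗ (map g (xs ++ ys)) ≡ sumₗ (map g xs) + sumₗ (map g ys)
sumₗ-map-++ g xs ys = trans (cong sumₗ (ListP.map-++ g xs ys)) (sumₗ-++ (map g xs) (map g ys))

sumₗ-map-tabulate : ∀ {a} {A : Set a} {d} (g : A → ℕ) (f : Fin d → A) →
  sumₗ (map g (toList (tabulate f))) ≡ ∑[ i < d ] g (f i)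
sumₗ-map-tabulate {d = zero}  g f = refl
sumₗ-map-tabulate {d = suc d} g f = cong (g (f zero) +_) (sumₗ-map-tabulate g (f ∘ suc))

-- Multiset equality, witnessed by every additive statistic.
infix 4 _≈ₘ_
record _≈ₘ_ {k} (u v : List (Fin k)) : Set where
  constructor mk≈ₘ
  field sumₗ-map-≡ : ∀ g → sumₗ (map g u) ≡ sumₗ (map g v)
open _≈ₘ_

++-≈ₘ : ∀ {k} {u u′ v v′ : List (Fin k)} → u ≈ₘ u′ → v ≈ₘ v′ → u ++ v ≈ₘ u′ ++ v′
++-≈ₘ {u = u} {u′} {v} {v′} u≈u′ v≈v′ = mk≈ₘ λ g → begin
  sumₗ (map g (u ++ v))                ≡⟨ sumₗ-map-++ g u v ⟩
  sumₗ (map g u) + sumₗ (map g v)      ≡⟨ cong₂ _+_ (sumₗ-map-≡ u≈u′ g) (sumₗ-map-≡ v≈v′ g) ⟩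
  sumₗ (map g u′) + sumₗ (map g v′)    ≡⟨ sumₗ-map-++ g u′ v′ ⟨
  sumₗ (map g (u′ ++ v′))              ∎
  where open ≡-Reasoning

inv-tabulate : ∀ {d k} (w : Fin d → Fin k) → inv (toList (tabulate w)) ≡ inversions w
inv-tabulate {zero}  w = refl
inv-tabulate {suc d} w = cong₂ _+_
  (trans (length-filter≡sumₗ (_<? w zero) (toList (tabulate (w ∘ suc))))
         (sumₗ-map-tabulate (λ y → χ (y <ᵇ w zero)) (w ∘ suc)))
  (inv-tabulate (w ∘ suc))

countBelow : ∀ {k} → Fin k → List (Fin k) → ℕ
countBelow x v = length (filter (_<? x) v)

crossInversions : ∀ {k} → List (Fin k) → List (Fin k) → ℕ
crossInversions u v = sumₗ (map (λ x → countBelow x v) u)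

countBelow-≈ₘ : ∀ {k} (x : Fin k) {v v′ : List (Fin k)} → v ≈ₘ v′ → countBelow x v ≡ countBelow x v′
countBelow-≈ₘ x {v} {v′} v≈v′ = begin
  countBelow x v                   ≡⟨ length-filter≡sumₗ (_<? x) v ⟩
  sumₗ (map (λ y → χ (y <ᵇ x)) v)  ≡⟨ sumₗ-map-≡ v≈v′ (λ y → χ (y <ᵇ x)) ⟩
  sumₗ (map (λ y → χ (y <ᵇ x)) v′) ≡⟨ length-filter≡sumₗ (_<? x) v′ ⟨
  countBelow x v′                  ∎
  where open ≡-Reasoning

inv-++ : ∀ {k} (u v : List (Fin k)) → inv (u ++ v) ≡ (inv u + inv v) + crossInversions u v
inv-++ []      v = sym (ℕP.+-identityʳ (inv v))
inv-++ (x ∷ u) v = begin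
  countBelow x (u ++ v) + inv (u ++ v)
    ≡⟨ cong₂ _+_ (trans (cong length (ListP.filter-++ (_<? x) u v))
                        (ListP.length-++ (filter (_<? x) u)))
                 (inv-++ u v) ⟩
  (countBelow x u + countBelow x v) + ((inv u + inv v) + crossInversions u v)
    ≡⟨ regroup (countBelow x u) (countBelow x v) (inv u) (inv v) (crossInversions u v) ⟩
  ((countBelow x u + inv u) + inv v) + (countBelow x v + crossInversions u v) ∎
  where
  open ≡-Reasoning
  regroup : ∀ a b c d e → (a + b) + ((c + d) + e) ≡ ((a + c) + d) + (b + e)
  regroup = solve-∀

crossInversions-≈ₘ : ∀ {k} {u u′ v v′ : List (Fin k)} → u ≈ₘ u′ → v ≈ₘ v′ →
  crossInversions u v ≡ crossInversions u′ v′
crossInversions-≈ₘ {u′ = u′} {v} u≈u′ v≈v′ =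
  trans (sumₗ-map-≡ u≈u′ (λ x → countBelow x v))
        (cong sumₗ (ListP.map-cong (λ x → countBelow-≈ₘ x v≈v′) u′))

sgnWord : ∀ {k} → List (Fin k) → ℤ
sgnWord w = neg1^ (inv w)

sgnWord-++ : ∀ {k} (u v : List (Fin k)) →
  sgnWord (u ++ v) ≡ (sgnWord u * sgnWord v) * neg1^ (crossInversions u v)
sgnWord-++ u v = begin
  neg1^ (inv (u ++ v))                 ≡⟨ cong neg1^ (inv-++ u v) ⟩
  neg1^ ((inv u + inv v) + c)          ≡⟨ neg1^-+ (inv u + inv v) c ⟩
  neg1^ (inv u + inv v) * neg1^ c      ≡⟨ cong (_* neg1^ c) (neg1^-+ (inv u) (inv v)) ⟩
  (sgnWord u * sgnWord v) * neg1^ c    ∎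
  where
  open ≡-Reasoning
  c = crossInversions u v

sgnWord-++-≈ₘ : ∀ {k} {u u′ v v′ : List (Fin k)} {a b : ℤ} → u ≈ₘ u′ → v ≈ₘ v′ →
  sgnWord u ≡ a * sgnWord u′ → sgnWord v ≡ b * sgnWord v′ →
  sgnWord (u ++ v) ≡ (a * b) * sgnWord (u′ ++ v′)
sgnWord-++-≈ₘ {u = u} {u′} {v} {v′} {a} {b} u≈u′ v≈v′ sgn-u sgn-v = begin
  sgnWord (u ++ v)                            ≡⟨ sgnWord-++ u v ⟩
  (sgnWord u * sgnWord v) * neg1^ c           ≡⟨ cong₂ (λ x y → (x * y) * neg1^ c) sgn-u sgn-v ⟩
  ((a * x′) * (b * y′)) * neg1^ c             ≡⟨ cong (λ n → ((a * x′) * (b * y′)) * neg1^ n)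
                                                     (crossInversions-≈ₘ u≈u′ v≈v′) ⟩
  ((a * x′) * (b * y′)) * neg1^ c′            ≡⟨ regroup a x′ b y′ (neg1^ c′) ⟩
  (a * b) * ((x′ * y′) * neg1^ c′)            ≡⟨ cong ((a * b) *_) (sgnWord-++ u′ v′) ⟨
  (a * b) * sgnWord (u′ ++ v′)                ∎
  where
  open ≡-Reasoning
  x′ = sgnWord u′
  y′ = sgnWord v′
  c  = crossInversions u v
  c′ = crossInversions u′ v′
  regroup : ∀ a x b y z → ((a * x) * (b * y)) * z ≡ (a * b) * ((x * y) * z)
  regroup = ℤSolver.solve-∀

Row : ℕ → ℕ → Set
Row n d = Vec (Maybe (Fin n)) d

rowWord : ∀ {n d} → Row n d → List (Fin n)
rowWord row = mapMaybe id (toList row)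

permuteRow : ∀ {n d} → Permutation′ d → Row n d → Row n d
permuteRow σ row = tabulate (λ k → lookup row (σ ⟨$⟩ˡ k))

lookup-permuteRow : ∀ {n d} (σ : Permutation′ d) (row : Row n d) k →
  lookup (permuteRow σ row) k ≡ lookup row (σ ⟨$⟩ˡ k)
lookup-permuteRow σ row = VecP.lookup∘tabulate (λ k → lookup row (σ ⟨$⟩ˡ k))

sumₗ-map-rowWord : ∀ {n d} (g : Fin n → ℕ) (row : Row n d) →
  sumₗ (map g (rowWord row)) ≡ ∑[ k < d ] maybe′ g 0 (lookup row k)
sumₗ-map-rowWord g []             = refl
sumₗ-map-rowWord g (nothing ∷ row) = sumₗ-map-rowWord g row
sumₗ-map-rowWord g (just x ∷ row)  = cong (g x +_) (sumₗ-map-rowWord g row)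

rowWord-permuteRow-≈ₘ : ∀ {n d} (σ : Permutation′ d) (row : Row n d) →
  rowWord row ≈ₘ rowWord (permuteRow σ row)
rowWord-permuteRow-≈ₘ {d = d} σ row = mk≈ₘ λ g → begin
  sumₗ (map g (rowWord row))                     ≡⟨ sumₗ-map-rowWord g row ⟩
  ∑[ k < d ] maybe′ g 0 (lookup row k)           ≡⟨ sum-permute (maybe′ g 0 ∘ lookup row) (flip σ) ⟩
  ∑[ k < d ] maybe′ g 0 (lookup row (σ ⟨$⟩ˡ k))  ≡⟨ sum-cong-≗ (cong (maybe′ g 0) ∘ lookup-permuteRow σ row)
                                                  ⟨
  ∑[ k < d ] maybe′ g 0 (lookup (permuteRow σ row) k) ≡⟨ sumₗ-map-rowWord g (permuteRow σ row) ⟨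
  sumₗ (map g (rowWord (permuteRow σ row)))      ∎
  where open ≡-Reasoning

FullRow : ∀ {n d} → Row n d → Set
FullRow {n} {d} row =
  Σ (Fin d → Fin n) λ a → Injective _≡_ _≡_ a × (∀ k → lookup row k ≡ just (a k))

SingleRow : ∀ {n d} → Row n d → Set
SingleRow {n} {d} row = Σ (Fin d) λ j → Σ (Fin n) λ x →
  lookup row j ≡ just x × (∀ k → k ≢ j → lookup row k ≡ nothing)

rowWord-full : ∀ {n d} (row : Row n d) (a : Fin d → Fin n) → (∀ k → lookup row k ≡ just (a k)) →
  rowWord row ≡ toList (tabulate a)
rowWord-full []        a filled = refl
rowWord-full (c ∷ row) a filled rewrite filled zero =
  cong (a zero ∷_) (rowWord-full row (a ∘ suc) (filled ∘ suc))

rowWord-empty : ∀ {n d} (row : Row n d) → (∀ k → lookup row k ≡ nothing) → rowWord row ≡ []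
rowWord-empty []        empty = refl
rowWord-empty (c ∷ row) empty rewrite empty zero = rowWord-empty row (empty ∘ suc)

rowWord-single : ∀ {n d} (row : Row n d) j x → lookup row j ≡ just x →
  (∀ k → k ≢ j → lookup row k ≡ nothing) → rowWord row ≡ x ∷ []
rowWord-single (c ∷ row) zero    x filled others rewrite filled =
  cong (x ∷_) (rowWord-empty row (λ k → others (suc k) λ ()))
rowWord-single (c ∷ row) (suc j) x filled others rewrite others zero (λ ()) =
  rowWord-single row j x filled (λ k k≢j → others (suc k) (k≢j ∘ FinP.suc-injective))

sgnWord-tabulate : ∀ {d k} (w : Fin d → Fin k) → sgnWord (toList (tabulate w)) ≡ sgn w
sgnWord-tabulate w = cong neg1^ (inv-tabulate w)

sgnWord-permuteRow-full : ∀ {n d} (σ : Permutation′ d) (row : Row n d) → FullRow row →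
  sgnWord (rowWord row) ≡ sgnPerm σ * sgnWord (rowWord (permuteRow σ row))
sgnWord-permuteRow-full σ row (a , a-inj , filled) = begin
  sgnWord (rowWord row)
    ≡⟨ cong sgnWord (rowWord-full row a filled) ⟩
  sgnWord (toList (tabulate a))
    ≡⟨ sgnWord-tabulate a ⟩
  sgn a
    ≡⟨ sgn-∘ a (flip σ) a-inj ⟩
  sgn (σ ⟨$⟩ˡ_) * sgn a′
    ≡⟨ cong₂ _*_ (trans (sgn-inverse σ) (sym (sgnWord-tabulate (σ ⟨$⟩ʳ_)))) (sym (sgnWord-tabulate a′)) ⟩
  sgnPerm σ * sgnWord (toList (tabulate a′))
    ≡⟨ cong (λ w → sgnPerm σ * sgnWord w) (rowWord-full (permuteRow σ row) a′ filled′) ⟨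
  sgnPerm σ * sgnWord (rowWord (permuteRow σ row)) ∎
  where
  open ≡-Reasoning
  a′ = λ k → a (σ ⟨$⟩ˡ k)
  filled′ : ∀ k → lookup (permuteRow σ row) k ≡ just (a′ k)
  filled′ k = trans (lookup-permuteRow σ row k) (filled (σ ⟨$⟩ˡ k))

rowWord-permuteRow-single : ∀ {n d} (σ : Permutation′ d) (row : Row n d) → SingleRow row →
  rowWord (permuteRow σ row) ≡ rowWord row
rowWord-permuteRow-single σ row (j , x , filled , others) = trans
  (rowWord-single (permuteRow σ row) (σ ⟨$⟩ʳ j) x
    (trans (lookup-permuteRow σ row _) (trans (cong (lookup row) (inverseˡ σ)) filled))
    (λ k k≢σj → trans (lookup-permuteRow σ row k)
      (others (σ ⟨$⟩ˡ k) (λ σ⁻¹k≡j → k≢σj (trans (sym (inverseʳ σ)) (cong (σ ⟨$⟩ʳ_) σ⁻¹k≡j))))))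
  (sym (rowWord-single row j x filled others))

readingWord-permCols-≈ₘ : ∀ {n d m} (σ : Permutation′ d) (T : Array n m d) →
  readingWord T ≈ₘ readingWord (permCols σ T)
readingWord-permCols-≈ₘ σ []        = mk≈ₘ λ g → refl
readingWord-permCols-≈ₘ σ (row ∷ T) =
  ++-≈ₘ (rowWord-permuteRow-≈ₘ σ row) (readingWord-permCols-≈ₘ σ T)

sgnT-permCols : ∀ {n d} (σ : Permutation′ d) r {m} (T : Array n m d) → r ≤ m →
  (∀ i → toℕ i < r → FullRow (lookup T i)) → (∀ i → r ≤ toℕ i → SingleRow (lookup T i)) →
  sgnT T ≡ sgnPerm σ ^ r * sgnT (permCols σ T)
sgnT-permCols σ zero    []        _         full single = refl
sgnT-permCols σ zero    (row ∷ T) _         full single =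
  sgnWord-++-≈ₘ {a = 1ℤ} {b = 1ℤ} (rowWord-permuteRow-≈ₘ σ row) (readingWord-permCols-≈ₘ σ T)
    (trans (cong sgnWord (sym (rowWord-permuteRow-single σ row (single zero z≤n))))
           (sym (ℤP.*-identityˡ _)))
    (sgnT-permCols σ zero T z≤n (λ i ()) (λ i _ → single (suc i) z≤n))
sgnT-permCols σ (suc r) (row ∷ T) (s≤s r≤m) full single =
  sgnWord-++-≈ₘ {a = sgnPerm σ} {b = sgnPerm σ ^ r}
    (rowWord-permuteRow-≈ₘ σ row) (readingWord-permCols-≈ₘ σ T)
    (sgnWord-permuteRow-full σ row (full zero (s≤s z≤n)))
    (sgnT-permCols σ r T r≤m (λ i i<r → full (suc i) (s≤s i<r))
                             (λ i r≤i → single (suc i) (s≤s r≤i)))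

predFin : ∀ {n} → Fin (suc n) → Maybe (Fin n)
predFin zero    = nothing
predFin (suc x) = just x

∣p∣≤-covering : ∀ {m n} (p : Subset n) (c : Fin m → Maybe (Fin n)) →
  (∀ {x} → x ∈ p → ∃ λ i → c i ≡ just x) → ∣ p ∣ ≤ m
∣p∣≤-covering []            c cover = z≤n
∣p∣≤-covering (outside ∷ p) c cover =
  ∣p∣≤-covering p (λ i → c i >>= predFin) λ x∈p →
    let i , cᵢ≡x = cover (there x∈p) in i , cong (_>>= predFin) cᵢ≡x
∣p∣≤-covering {zero}  (inside ∷ p) c cover = case proj₁ (cover here) of λ ()
∣p∣≤-covering {suc m} (inside ∷ p) c cover =
  s≤s (∣p∣≤-covering p (λ j → c (punchIn i₀ j) >>= predFin) cover′)
  where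
  i₀ = proj₁ (cover here)
  cover′ : ∀ {x} → x ∈ p → ∃ λ j → (c (punchIn i₀ j) >>= predFin) ≡ just x
  cover′ x∈p with cover (there x∈p)
  ... | i , cᵢ≡x =
    punchOut i₀≢i , cong (_>>= predFin) (trans (cong c (FinP.punchIn-punchOut i₀≢i)) cᵢ≡x)
    where
    i₀≢i : i₀ ≢ i
    i₀≢i refl = case trans (sym (proj₂ (cover here))) cᵢ≡x of λ ()

Is-just⇒≡just : ∀ {A : Set} {m : Maybe A} (m-just : Is-just m) → m ≡ just (to-witness m-just)
Is-just⇒≡just (MaybeAny.just _) = refl

cell-permCols : ∀ {n m d} (σ : Permutation′ d) (T : Array n m d) i k →
  cell (permCols σ T) i k ≡ cell T i (σ ⟨$⟩ˡ k)
cell-permCols σ T i k = trans (cong (λ row → lookup row k) (VecP.lookup-map i (permuteRow σ) T))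
                              (lookup-permuteRow σ (lookup T i) k)

permCols-jellyfish : ∀ {n d r} (σ : Permutation′ d) {π π′ : Fin d → Subset n} →
  (∀ k → π′ k ≡ π (σ ⟨$⟩ˡ k)) →
  ∀ {T} → IsJellyfish n d r π T → IsJellyfish n d r π′ (permCols σ T)
permCols-jellyfish {n} {d} {r} σ {π} {π′} π′≡π∘σ⁻¹ {T} J = record
  { topFull    = λ i k i<r → subst Is-just (sym (cell-permCols σ T i k)) (topFull i (σ ⟨$⟩ˡ k) i<r)
  ; lowerOne   = λ i r≤i → lowerOne′ i (lowerOne i r≤i)
  ; columns    = λ k x → mk⇔
      (λ x∈π′k →
         let i , cell≡x = Equivalence.to (columns (σ ⟨$⟩ˡ k) x) (subst (x ∈_) (π′≡π∘σ⁻¹ k) x∈π′k)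
         in i , trans (cell-permCols σ T i k) cell≡x)
      (λ (i , cell≡x) → subst (x ∈_) (sym (π′≡π∘σ⁻¹ k))
         (Equivalence.from (columns (σ ⟨$⟩ˡ k) x) (i , trans (sym (cell-permCols σ T i k)) cell≡x)))
  ; increasing = λ k i i′ a b i<i′ cell≡a cell≡b → increasing (σ ⟨$⟩ˡ k) i i′ a b i<i′
      (trans (sym (cell-permCols σ T i k)) cell≡a) (trans (sym (cell-permCols σ T i′ k)) cell≡b)
  }
  where
  open IsJellyfish J
  LowerRow : Array n (rows n d r) d → Fin (rows n d r) → Set
  LowerRow U i = Σ (Fin d) λ j → Is-just (cell U i j) × (∀ k → k ≢ j → cell U i k ≡ nothing)
  lowerOne′ : ∀ i → LowerRow T i → LowerRow (permCols σ T) i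
  lowerOne′ i (j , filled , others) = σ ⟨$⟩ʳ j ,
    subst Is-just (sym (trans (cell-permCols σ T i (σ ⟨$⟩ʳ j)) (cong (cell T i) (inverseˡ σ))))
      filled ,
    λ k k≢σj → trans (cell-permCols σ T i k)
      (others (σ ⟨$⟩ˡ k) (λ σ⁻¹k≡j → k≢σj (trans (sym (inverseʳ σ)) (cong (σ ⟨$⟩ʳ_) σ⁻¹k≡j))))

permuteRow-flip : ∀ {n d} (σ : Permutation′ d) (row : Row n d) →
  permuteRow (flip σ) (permuteRow σ row) ≡ row
permuteRow-flip σ row = trans
  (VecP.tabulate-cong λ k →
     trans (lookup-permuteRow σ row (σ ⟨$⟩ʳ k)) (cong (lookup row) (inverseˡ σ)))
  (VecP.tabulate∘lookup row)

permCols-flip : ∀ {n m d} (σ : Permutation′ d) (T : Array n m d) →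
  permCols (flip σ) (permCols σ T) ≡ T
permCols-flip σ []        = refl
permCols-flip σ (row ∷ T) = cong₂ _∷_ (permuteRow-flip σ row) (permCols-flip σ T)

module _ {n d r} {π : Fin d → Subset n} {T : Array n (rows n d r) d}
         (J : IsJellyfish n d r π T) where
  open IsJellyfish J

  jellyfish-singleRow : ∀ i → r ≤ toℕ i → SingleRow (lookup T i)
  jellyfish-singleRow i r≤i =
    let j , filled , others = lowerOne i r≤i in j , to-witness filled , Is-just⇒≡just filled , others

  jellyfish-fullRow : (∀ j k → j ≢ k → Empty (π j ∩ π k)) → ∀ i → toℕ i < r → FullRow (lookup T i)
  jellyfish-fullRow disjoint i i<r = a , a-injective , (λ k → Is-just⇒≡just (topFull i k i<r))
    where
    a : Fin d → Fin n
    a k = to-witness (topFull i k i<r)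
    a∈π : ∀ k → a k ∈ π k
    a∈π k = Equivalence.from (columns k (a k)) (i , Is-just⇒≡just (topFull i k i<r))
    a-injective : Injective _≡_ _≡_ a
    a-injective {j} {k} aj≡ak with j ≟ k
    ... | yes j≡k = j≡k
    ... | no  j≢k = ⊥-elim (disjoint j k j≢k
                              (a j , SubsetP.x∈p∩q⁺ (a∈π j , subst (_∈ π k) (sym aj≡ak) (a∈π k))))

  ∣column∣≤rows : ∀ j → ∣ π j ∣ ≤ rows n d r
  ∣column∣≤rows j = ∣p∣≤-covering (π j) (λ i → cell T i j) (Equivalence.to (columns j _))

readingWord-no-columns : ∀ {n m} (T : Array n m 0) → readingWord T ≡ []
readingWord-no-columns []       = refl
readingWord-no-columns ([] ∷ T) = readingWord-no-columns T

sgnT-permCols-jellyfish : ∀ {n d r} {π : Fin d → Subset n} → InOP n d r π → (σ : Permutation′ d) →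
  ∀ {T} → IsJellyfish n d r π T → sgnT T ≡ sgnPerm σ ^ r * sgnT (permCols σ T)
-- Without columns r may exceed the number of rows, but both reading words are empty.
sgnT-permCols-jellyfish {d = zero} {r} op σ {T} J = begin
  sgnT T                        ≡⟨ cong sgnWord (readingWord-no-columns T) ⟩
  1ℤ                            ≡⟨ trans (ℤP.*-identityʳ _) (ℤP.^-zeroˡ r) ⟨
  1ℤ ^ r * 1ℤ                   ≡⟨ cong (λ w → 1ℤ ^ r * sgnWord w) (readingWord-no-columns (permCols σ T)) ⟨
  1ℤ ^ r * sgnT (permCols σ T)  ∎
  where open ≡-Reasoning
sgnT-permCols-jellyfish {d = suc d} {r} op σ {T} J =
  sgnT-permCols σ r T (ℕP.≤-trans (bigBlock zero) (∣column∣≤rows J zero))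
    (jellyfish-fullRow J (IsOrderedSetPartition.disjoint isOSP)) (jellyfish-singleRow J)
  where open InOP op

lemma3p3 : (n d r : ℕ) (π : Fin d → Subset n) → InOP n d r π →
    (σ : Permutation′ d) →
    ((T : Array n (rows n d r) d) → IsJellyfish n d r π T →
      IsJellyfish n d r (permPart σ π) (permCols σ T))
    × ((T U : Array n (rows n d r) d) → IsJellyfish n d r π T →
      IsJellyfish n d r π U → permCols σ T ≡ permCols σ U → T ≡ U)
    × ((T′ : Array n (rows n d r) d) → IsJellyfish n d r (permPart σ π) T′ →
      ∃ λ T → IsJellyfish n d r π T × permCols σ T ≡ T′)
    × ((T : Array n (rows n d r) d) → IsJellyfish n d r π T →
      sgnT T ≡ (sgnPerm σ ^ r) * sgnT (permCols σ T))
lemma3p3 n d r π op σ =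
    (λ T J → permCols-jellyfish σ (λ k → refl) J)
  , (λ T U _ _ σT≡σU → begin
       T                              ≡⟨ permCols-flip σ T ⟨
       permCols (flip σ) (permCols σ T) ≡⟨ cong (permCols (flip σ)) σT≡σU ⟩
       permCols (flip σ) (permCols σ U) ≡⟨ permCols-flip σ U ⟩
       U                              ∎)
  , (λ T′ J′ → permCols (flip σ) T′
             , permCols-jellyfish (flip σ) (λ k → cong π (sym (inverseˡ σ))) J′
             , permCols-flip (flip σ) T′)
  , (λ T J → sgnT-permCols-jellyfish op σ J)
  where open ≡-Reasoning
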